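{- Let $n\ge 6$ be an integer. Let $G$ be a $3$-graph on $[n]$ with no isolated vertex that does not contain two disjoint edges and is left-compressed relative to the natural order on $[n]$. Then (a) $\{1,2,i\}\in E(G)$ for all $i\in\{3,\dots,n\}$; (b) $\{1,2\}$ is a vertex cover of $G$, i.e. every edge of $G$ meets $\{1,2\}$; (c) the graph $L^+(2)=\{A\subseteq\{3,\dots,n\}: A\cup\{2\}\in E(G)\}$ contains no two disjoint edges; thus, if $L^+(2)\neq\emptyset$, then $L^+(2)$ is either a triangle or a star (all of its edges share a common vertex).
   Context: A $3$-graph is a vertex set with a family of $3$-element subsets (edges). For distinct $i,j\in[n]$, let $L_G(j\setminus i)=\{f\subseteq[n]\setminus\{i,j\}:|f|=2, f\cup\{j\}\in E(G), f\cup\{i\}\notin E(G)\}$ and let $\pi_{ij}(G)$ have edge set $(E(G)\setminus\{f\cup\{j\}:f\in L_G(j\setminus i)\})\cup\{f\cup\{i\}:f\in L_G(j\setminus i)\}$. $G$ is left-compressed relative to the natural order if $\pi_{ij}(G)=G$ for all $i<j$. -}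

module Defs where

open import Data.Nat using (ℕ; _≤_)
open import Data.Bool using (Bool; true)
open import Data.Fin using (Fin; toℕ) renaming (_<_ to _<ᶠ_)
open import Data.Fin.Subset using (Subset; _∈_; _∉_; _∪_; _∩_; ⁅_⁆; ∣_∣; ⊥)
open import Data.Product using (Σ; _×_; ∃; ∃-syntax)
open import Data.Sum using (_⊎_)
open import Relation.Binary.PropositionalEquality using (_≡_)
open import Relation.Nullary using (¬_)
open import Function.Bundles using (_⇔_)

-- A 3-graph on the vertex set Fin n (vertex k of Fin n is vertex k+1 of [n]).
record ThreeGraph (n : ℕ) : Set where
  field
    edge     : Subset n → Bool
    uniform  : ∀ A → edge A ≡ true → ∣ A ∣ ≡ 3

open ThreeGraph public

_∈E_ : ∀ {n} → Subset n → ThreeGraph n → Set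
A ∈E G = edge G A ≡ true

Disjoint : ∀ {n} → Subset n → Subset n → Set
Disjoint A B = A ∩ B ≡ ⊥

NoIsolated : ∀ {n} → ThreeGraph n → Set
NoIsolated {n} G = ∀ (v : Fin n) → ∃[ A ] (A ∈E G × v ∈ A)

NoTwoDisjointEdges : ∀ {n} → ThreeGraph n → Set
NoTwoDisjointEdges G = ∀ A B → A ∈E G → B ∈E G → ¬ Disjoint A B

L : ∀ {n} → ThreeGraph n → Fin n → Fin n → Subset n → Set
L G j i f = ∣ f ∣ ≡ 2 × i ∉ f × j ∉ f × (f ∪ ⁅ j ⁆) ∈E G × ¬ ((f ∪ ⁅ i ⁆) ∈E G)

πEdge : ∀ {n} → ThreeGraph n → Fin n → Fin n → Subset n → Set
πEdge G i j A =
  (A ∈E G × ¬ (∃[ f ] (L G j i f × A ≡ f ∪ ⁅ j ⁆)))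
  ⊎ (∃[ f ] (L G j i f × A ≡ f ∪ ⁅ i ⁆))

LeftCompressed : ∀ {n} → ThreeGraph n → Set
LeftCompressed {n} G = ∀ (i j : Fin n) → i <ᶠ j → ∀ A → (πEdge G i j A ⇔ A ∈E G)

-- A ⊆ {3,…,n}  (in 0-based Fin indexing: all elements have index ≥ 2)
AboveTwo : ∀ {n} → Subset n → Set
AboveTwo {n} A = ∀ (x : Fin n) → x ∈ A → 2 ≤ toℕ x

-- 2-graph L⁺(2) = {A ⊆ {3..n} : A ∪ {2} ∈ E(G)}; vertex 2 of [n] is Fin index 1.
module _ {n : ℕ} where
  LPlus : (v : Fin n) → ThreeGraph n → Subset n → Set
  LPlus v G A = AboveTwo A × (A ∪ ⁅ v ⁆) ∈E G

IsStar : ∀ {n} → (Subset n → Set) → Set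
IsStar {n} P = ∃[ v ] (∀ A → P A → v ∈ A)

IsTriangle : ∀ {n} → (Subset n → Set) → Set
IsTriangle {n} P = ∃[ a ] ∃[ b ] ∃[ c ] (¬ a ≡ b × ¬ b ≡ c × ¬ a ≡ c ×
  (∀ A → P A ⇔ ((A ≡ ⁅ a ⁆ ∪ ⁅ b ⁆) ⊎ (A ≡ ⁅ b ⁆ ∪ ⁅ c ⁆) ⊎ (A ≡ ⁅ a ⁆ ∪ ⁅ c ⁆))))

-- Left-compression lets every edge be pushed down, vertex by vertex, without
-- leaving G. Pushing an edge through the last vertex ℓ onto 1 and then 2 gives
-- {1,2,ℓ}, and pushing ℓ down gives every {1,2,i}. An edge avoiding 1 and 2
-- would have to meet all of these, so it would contain {3,4,5,6}. If two
-- members A, B of L⁺(2) were disjoint, pushing A ∪ {2} to A ∪ {1} would give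
-- two disjoint edges. Finally, pairwise intersecting 2-sets form a star or a
-- triangle: if neither a nor b is common to all of them, where {a,b} is one of
-- them, the family is forced to be {ab, bc, ac}.
module Submission where

open import Defs
open import Algebra.Bundles using (CommutativeMonoid)
import Algebra.Properties.CommutativeSemigroup as CommutativeSemigroupProperties
open import Data.Nat using (ℕ; zero; suc; _+_; _≤_; _<_; z≤n; s≤s)
import Data.Nat.Properties as ℕ
open import Data.Bool using (true)
import Data.Bool.Properties as Bool
open import Data.Fin using (Fin; zero; suc; toℕ; fromℕ) renaming (_<_ to _<ᶠ_)
import Data.Fin.Properties as Fin
open import Data.Fin.Subset
open import Data.Fin.Subset.Properties
open import Data.Vec using (_∷_; _[_]=_)
open _[_]=_
open import Data.Product using (_×_; _,_; ∃-syntax)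
import Data.Sum as Sum
open Sum using (_⊎_; inj₁; inj₂; [_,_]′)
open import Data.Empty using (⊥-elim)
open import Function using (_∘_)
open import Function.Bundles using (_⇔_; mk⇔; Equivalence)
open import Relation.Binary.PropositionalEquality
open import Relation.Nullary using (¬_; yes; no; contradiction)
open import Relation.Nullary.Decidable using (_×-dec_; _→-dec_; ¬?; decidable-stable)
open import Relation.Unary using (Decidable)

private
  variable
    n : ℕ
    p q K e : Subset n
    x y v i j : Fin n
    G : ThreeGraph n

∣p∣≡1+∣p-x∣ : x ∈ p → ∣ p ∣ ≡ suc ∣ p - x ∣
∣p∣≡1+∣p-x∣ {x = zero}  {p = inside ∷ p}  here      = cong (suc ∘ ∣_∣) (sym (p─⊥≡p p))
∣p∣≡1+∣p-x∣ {x = suc x} {p = outside ∷ p} (there x∈p) = ∣p∣≡1+∣p-x∣ x∈p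
∣p∣≡1+∣p-x∣ {x = suc x} {p = inside ∷ p}  (there x∈p) = cong suc (∣p∣≡1+∣p-x∣ x∈p)

∣⁅x⁆∪p∣≡1+∣p∣ : x ∉ p → ∣ ⁅ x ⁆ ∪ p ∣ ≡ suc ∣ p ∣
∣⁅x⁆∪p∣≡1+∣p∣ {x = zero}  {p = outside ∷ p} x∉p = cong (suc ∘ ∣_∣) (∪-identityˡ p)
∣⁅x⁆∪p∣≡1+∣p∣ {x = zero}  {p = inside ∷ p}  x∉p = contradiction here x∉p
∣⁅x⁆∪p∣≡1+∣p∣ {x = suc x} {p = outside ∷ p} x∉p = ∣⁅x⁆∪p∣≡1+∣p∣ (x∉p ∘ there)
∣⁅x⁆∪p∣≡1+∣p∣ {x = suc x} {p = inside ∷ p}  x∉p = cong suc (∣⁅x⁆∪p∣≡1+∣p∣ (x∉p ∘ there))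

x∉p-x : ∀ (p : Subset n) → x ∉ p - x
x∉p-x {x = zero}  (_ ∷ p) ()
x∉p-x {x = suc x} (_ ∷ p) (there x∈p-x) = x∉p-x p x∈p-x

p-x∪⁅x⁆≡p : x ∈ p → (p - x) ∪ ⁅ x ⁆ ≡ p
p-x∪⁅x⁆≡p {x = zero}  {p = inside ∷ p}  here        =
  cong (inside ∷_) (trans (∪-identityʳ (p ─ ⊥)) (p─⊥≡p p))
p-x∪⁅x⁆≡p {x = suc x} {p = outside ∷ p} (there x∈p) = cong (outside ∷_) (p-x∪⁅x⁆≡p x∈p)
p-x∪⁅x⁆≡p {x = suc x} {p = inside ∷ p}  (there x∈p) = cong (inside ∷_) (p-x∪⁅x⁆≡p x∈p)

⁅x⁆⊆p : x ∈ p → ⁅ x ⁆ ⊆ p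
⁅x⁆⊆p {p = p} x∈p y∈⁅x⁆ = subst (_∈ p) (sym (x∈⁅y⁆⇒x≡y _ y∈⁅x⁆)) x∈p

⁅x⁆∪p⊆q : x ∈ q → p ⊆ q → ⁅ x ⁆ ∪ p ⊆ q
⁅x⁆∪p⊆q x∈q p⊆q = [ ⁅x⁆⊆p x∈q , p⊆q ]′ ∘ x∈p∪q⁻ _ _

∣q∣<∣p∣⇒∃∈p∖q : ∣ q ∣ < ∣ p ∣ → ∃[ x ] (x ∈ p × x ∉ q)
∣q∣<∣p∣⇒∃∈p∖q {q = q} {p = p} ∣q∣<∣p∣ with Fin.any? (λ x → x ∈? p ×-dec ¬? (x ∈? q))
... | yes x∈p∖q = x∈p∖q
... | no p∖q-empty = contradiction (p⊆q⇒∣p∣≤∣q∣ p⊆q) (ℕ.<⇒≱ ∣q∣<∣p∣)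
  where
  p⊆q : p ⊆ q
  p⊆q {x} x∈p = decidable-stable (x ∈? q) (λ x∉q → p∖q-empty (x , x∈p , x∉q))

⊆∧∣q∣≤∣p∣⇒≡ : p ⊆ q → ∣ q ∣ ≤ ∣ p ∣ → p ≡ q
⊆∧∣q∣≤∣p∣⇒≡ {p = p} {q = q} p⊆q ∣q∣≤∣p∣ = ⊆-antisym p⊆q q⊆p
  where
  q⊆p : q ⊆ p
  q⊆p {x} x∈q = decidable-stable (x ∈? p)
    (λ x∉p → ℕ.<⇒≱ (p⊂q⇒∣p∣<∣q∣ (p⊆q , x , x∈q , x∉p)) ∣q∣≤∣p∣)

Disjoint⁺ : (∀ {x} → x ∈ p → x ∉ q) → Disjoint p q
Disjoint⁺ {p = p} {q = q} p∩q-empty =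
  Empty-unique λ (x , x∈p∩q) → let (x∈p , x∈q) = x∈p∩q⁻ p q x∈p∩q in p∩q-empty x∈p x∈q

¬Disjoint⇒∃∈p∩q : ¬ Disjoint p q → ∃[ x ] (x ∈ p × x ∈ q)
¬Disjoint⇒∃∈p∩q {p = p} {q = q} ¬disjoint with nonempty? (p ∩ q)
... | yes (x , x∈p∩q) = x , x∈p∩q⁻ p q x∈p∩q
... | no p∩q-empty = contradiction (Empty-unique p∩q-empty) ¬disjoint

x∈⁅y⁆∪⁅z⁆⁻ : ∀ (y z : Fin n) → x ∈ ⁅ y ⁆ ∪ ⁅ z ⁆ → x ≡ y ⊎ x ≡ z
x∈⁅y⁆∪⁅z⁆⁻ y z = Sum.map (x∈⁅y⁆⇒x≡y y) (x∈⁅y⁆⇒x≡y z) ∘ x∈p∪q⁻ ⁅ y ⁆ ⁅ z ⁆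

x∈⁅y⁆∪⁅z⁆∪⁅v⁆⁻ : ∀ (y z v : Fin n) → x ∈ ⁅ y ⁆ ∪ ⁅ z ⁆ ∪ ⁅ v ⁆ → x ≡ y ⊎ x ≡ z ⊎ x ≡ v
x∈⁅y⁆∪⁅z⁆∪⁅v⁆⁻ y z v = Sum.map (x∈⁅y⁆⇒x≡y y) (x∈⁅y⁆∪⁅z⁆⁻ z v) ∘ x∈p∪q⁻ ⁅ y ⁆ (⁅ z ⁆ ∪ ⁅ v ⁆)

∣⁅x⁆∪⁅y⁆∣≡2 : ∀ (x y : Fin n) → x ≢ y → ∣ ⁅ x ⁆ ∪ ⁅ y ⁆ ∣ ≡ 2
∣⁅x⁆∪⁅y⁆∣≡2 x y x≢y = trans (∣⁅x⁆∪p∣≡1+∣p∣ (x≢y⇒x∉⁅y⁆ x≢y)) (cong suc (∣⁅x⁆∣≡1 y))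

∣⁅x⁆∪⁅y⁆∪⁅z⁆∣≡3 : ∀ (x y z : Fin n) → x ≢ y → x ≢ z → y ≢ z → ∣ ⁅ x ⁆ ∪ ⁅ y ⁆ ∪ ⁅ z ⁆ ∣ ≡ 3
∣⁅x⁆∪⁅y⁆∪⁅z⁆∣≡3 x y z x≢y x≢z y≢z =
  trans (∣⁅x⁆∪p∣≡1+∣p∣ ([ x≢y , x≢z ]′ ∘ x∈⁅y⁆∪⁅z⁆⁻ y z)) (cong suc (∣⁅x⁆∪⁅y⁆∣≡2 y z y≢z))

∣p∣≡2⇒p≡⁅x⁆∪⁅y⁆ : ∣ p ∣ ≡ 2 → x ∈ p → y ∈ p → x ≢ y → p ≡ ⁅ x ⁆ ∪ ⁅ y ⁆
∣p∣≡2⇒p≡⁅x⁆∪⁅y⁆ {x = x} {y = y} ∣p∣≡2 x∈p y∈p x≢y = sym (⊆∧∣q∣≤∣p∣⇒≡ (⁅x⁆∪p⊆q x∈p (⁅x⁆⊆p y∈p))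
  (ℕ.≤-reflexive (trans ∣p∣≡2 (sym (∣⁅x⁆∪⁅y⁆∣≡2 x y x≢y)))))

∣p∣≡2⇒∃⁅x⁆∪⁅y⁆ : ∀ {n} {p : Subset n} → ∣ p ∣ ≡ 2 → ∃[ x ] ∃[ y ] (x ≢ y × p ≡ ⁅ x ⁆ ∪ ⁅ y ⁆)
∣p∣≡2⇒∃⁅x⁆∪⁅y⁆ {n = n} {p = p} ∣p∣≡2
  with ∣q∣<∣p∣⇒∃∈p∖q {q = ⊥} (subst₂ _<_ (sym (∣⊥∣≡0 n)) (sym ∣p∣≡2) (s≤s z≤n))
... | x , x∈p , _ with ∣q∣<∣p∣⇒∃∈p∖q {q = ⁅ x ⁆} (subst₂ _<_ (sym (∣⁅x⁆∣≡1 x)) (sym ∣p∣≡2) ℕ.≤-refl)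
...   | y , y∈p , y∉⁅x⁆ = x , y , x≢y , ∣p∣≡2⇒p≡⁅x⁆∪⁅y⁆ ∣p∣≡2 x∈p y∈p x≢y
  where
  x≢y : x ≢ y
  x≢y x≡y = y∉⁅x⁆ (subst (_∈ ⁅ x ⁆) x≡y (x∈⁅x⁆ x))

module _ {P : Subset n → Set} (P? : Decidable P) (∣P∣≡2 : ∀ {A} → P A → ∣ A ∣ ≡ 2)
         (intersecting : ∀ A B → P A → P B → ¬ Disjoint A B) where

  private
    meets-pair : ∀ {A} x y → P A → P (⁅ x ⁆ ∪ ⁅ y ⁆) → x ∈ A ⊎ y ∈ A
    meets-pair {A} x y A∈P xy∈P with ¬Disjoint⇒∃∈p∩q (intersecting A _ A∈P xy∈P)
    ... | z , z∈A , z∈xy = Sum.map (λ z≡x → subst (_∈ A) z≡x z∈A) (λ z≡y → subst (_∈ A) z≡y z∈A)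
                                   (x∈⁅y⁆∪⁅z⁆⁻ x y z∈xy)

    triangle : ∀ {x y z} → x ≢ y → y ≢ z → x ≢ z →
      P (⁅ x ⁆ ∪ ⁅ y ⁆) → P (⁅ y ⁆ ∪ ⁅ z ⁆) → P (⁅ x ⁆ ∪ ⁅ z ⁆) → IsTriangle P
    triangle {x} {y} {z} x≢y y≢z x≢z xy∈P yz∈P xz∈P =
      x , y , z , x≢y , y≢z , x≢z , λ A → mk⇔ classify spanned
      where
      pair : ∀ {A u w} → P A → u ∈ A → w ∈ A → u ≢ w → A ≡ ⁅ u ⁆ ∪ ⁅ w ⁆
      pair A∈P = ∣p∣≡2⇒p≡⁅x⁆∪⁅y⁆ (∣P∣≡2 A∈P)
      classify : ∀ {A} → P A → A ≡ ⁅ x ⁆ ∪ ⁅ y ⁆ ⊎ A ≡ ⁅ y ⁆ ∪ ⁅ z ⁆ ⊎ A ≡ ⁅ x ⁆ ∪ ⁅ z ⁆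
      classify A∈P with meets-pair x y A∈P xy∈P
      ... | inj₁ x∈A = Sum.map (λ y∈A → pair A∈P x∈A y∈A x≢y) (λ z∈A → inj₂ (pair A∈P x∈A z∈A x≢z))
                               (meets-pair y z A∈P yz∈P)
      ... | inj₂ y∈A = Sum.map (λ x∈A → pair A∈P x∈A y∈A x≢y) (λ z∈A → inj₁ (pair A∈P y∈A z∈A y≢z))
                               (meets-pair x z A∈P xz∈P)
      spanned : ∀ {A} → A ≡ ⁅ x ⁆ ∪ ⁅ y ⁆ ⊎ A ≡ ⁅ y ⁆ ∪ ⁅ z ⁆ ⊎ A ≡ ⁅ x ⁆ ∪ ⁅ z ⁆ → P A
      spanned (inj₁ refl)        = xy∈P
      spanned (inj₂ (inj₁ refl)) = yz∈P
      spanned (inj₂ (inj₂ refl)) = xz∈P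

    -- Each of C, D meets xy in exactly one point, so C = yz and D = xz, with the same z
    -- because D must also meet C.
    avoiders⇒triangle : ∀ {x y C D} → x ≢ y → P (⁅ x ⁆ ∪ ⁅ y ⁆) →
      P C → x ∉ C → P D → y ∉ D → IsTriangle P
    avoiders⇒triangle {x} {y} {C} {D} x≢y xy∈P C∈P x∉C D∈P y∉D
      with ∣q∣<∣p∣⇒∃∈p∖q {q = ⁅ y ⁆} {p = C} (subst₂ _<_ (sym (∣⁅x⁆∣≡1 y)) (sym (∣P∣≡2 C∈P)) ℕ.≤-refl)
    ... | z , z∈C , z∉⁅y⁆ =
      triangle x≢y y≢z x≢z xy∈P (subst P C≡yz C∈P) (subst P D≡xz D∈P)
      where
      y∈C : y ∈ C
      y∈C = [ (λ x∈C → contradiction x∈C x∉C) , (λ y∈C → y∈C) ]′ (meets-pair x y C∈P xy∈P)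
      x∈D : x ∈ D
      x∈D = [ (λ x∈D → x∈D) , (λ y∈D → contradiction y∈D y∉D) ]′ (meets-pair x y D∈P xy∈P)
      y≢z : y ≢ z
      y≢z y≡z = z∉⁅y⁆ (subst (_∈ ⁅ y ⁆) y≡z (x∈⁅x⁆ y))
      x≢z : x ≢ z
      x≢z x≡z = x∉C (subst (_∈ C) (sym x≡z) z∈C)
      C≡yz : C ≡ ⁅ y ⁆ ∪ ⁅ z ⁆
      C≡yz = ∣p∣≡2⇒p≡⁅x⁆∪⁅y⁆ (∣P∣≡2 C∈P) y∈C z∈C y≢z
      z∈D : z ∈ D
      z∈D = [ (λ y∈D → contradiction y∈D y∉D) , (λ z∈D → z∈D) ]′ (meets-pair y z D∈P (subst P C≡yz C∈P))
      D≡xz : D ≡ ⁅ x ⁆ ∪ ⁅ z ⁆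
      D≡xz = ∣p∣≡2⇒p≡⁅x⁆∪⁅y⁆ (∣P∣≡2 D∈P) x∈D z∈D x≢z

    star⊎avoider : ∀ x → IsStar P ⊎ ∃[ C ] (P C × x ∉ C)
    star⊎avoider x with anySubset? (λ C → P? C ×-dec ¬? (x ∈? C))
    ... | yes avoider  = inj₂ avoider
    ... | no ¬avoider =
      inj₁ (x , λ A A∈P → decidable-stable (x ∈? A) (λ x∉A → ¬avoider (A , A∈P , x∉A)))

  intersecting-pairs⇒triangle⊎star : ∃[ A ] P A → IsTriangle P ⊎ IsStar P
  intersecting-pairs⇒triangle⊎star (A , A∈P) with ∣p∣≡2⇒∃⁅x⁆∪⁅y⁆ {p = A} (∣P∣≡2 A∈P)
  ... | x , y , x≢y , A≡xy with star⊎avoider x | star⊎avoider y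
  ... | inj₁ star | _ = inj₂ star
  ... | inj₂ _ | inj₁ star = inj₂ star
  ... | inj₂ (C , C∈P , x∉C) | inj₂ (D , D∈P , y∉D) =
    inj₁ (avoiders⇒triangle x≢y (subst P A≡xy A∈P) C∈P x∉C D∈P y∉D)

πEdge-fixed⇒shift : i ≢ j → (∀ A → πEdge G i j A ⇔ A ∈E G) →
  ∀ {f} → ∣ f ∣ ≡ 2 → i ∉ f → j ∉ f → (f ∪ ⁅ j ⁆) ∈E G → (f ∪ ⁅ i ⁆) ∈E G
πEdge-fixed⇒shift {i = i} {j = j} {G = G} i≢j fixed {f} ∣f∣≡2 i∉f j∉f fj∈E
  with edge G (f ∪ ⁅ i ⁆) Bool.≟ true
... | yes fi∈E = fi∈E
... | no fi∉E with Equivalence.from (fixed (f ∪ ⁅ j ⁆)) fj∈E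
...   | inj₁ (_ , unshifted) = contradiction (f , (∣f∣≡2 , i∉f , j∉f , fj∈E , fi∉E) , refl) unshifted
...   | inj₂ (f′ , _ , fj≡f′i) = -- f ∪ ⁅ j ⁆ would be a shifted edge, so it would contain i
  ⊥-elim ([ i∉f , i≢j ∘ x∈⁅y⁆⇒x≡y j ]′
    (x∈p∪q⁻ f ⁅ j ⁆ (subst (i ∈_) (sym fj≡f′i) (x∈p∪q⁺ (inj₂ (x∈⁅x⁆ i))))))

compressed⇒shift : LeftCompressed G → i <ᶠ j →
  ∀ {f} → ∣ f ∣ ≡ 2 → i ∉ f → j ∉ f → (f ∪ ⁅ j ⁆) ∈E G → (f ∪ ⁅ i ⁆) ∈E G
compressed⇒shift {G = G} compressed i<j = πEdge-fixed⇒shift {G = G} (Fin.<⇒≢ i<j) (compressed _ _ i<j)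

compressed⇒shift-edge : LeftCompressed G → i <ᶠ j → e ∈E G → j ∈ e → i ∉ e → ((e - j) ∪ ⁅ i ⁆) ∈E G
compressed⇒shift-edge {G = G} {j = j} {e = e} compressed i<j e∈E j∈e i∉e =
  compressed⇒shift {G = G} compressed i<j ∣e-j∣≡2 (i∉e ∘ p─q⊆p e ⁅ j ⁆) (x∉p-x e)
    (subst (_∈E G) (sym (p-x∪⁅x⁆≡p j∈e)) e∈E)
  where
  ∣e-j∣≡2 : ∣ e - j ∣ ≡ 2
  ∣e-j∣≡2 = ℕ.suc-injective (trans (sym (∣p∣≡1+∣p-x∣ j∈e)) (uniform G e e∈E))

-- Shift a vertex of e outside K down to v.
compressed⇒absorb : LeftCompressed G → e ∈E G → K ⊆ e → ∣ K ∣ < 3 →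
  (∀ {y} → y ∉ K → y ≢ v → toℕ v < toℕ y) → ∃[ e′ ] (e′ ∈E G × ⁅ v ⁆ ∪ K ⊆ e′)
compressed⇒absorb {G = G} {e = e} {K = K} {v = v} compressed e∈E K⊆e ∣K∣<3 above with v ∈? e
... | yes v∈e = e , e∈E , ⁅x⁆∪p⊆q v∈e K⊆e
... | no v∉e with ∣q∣<∣p∣⇒∃∈p∖q (subst (∣ K ∣ <_) (sym (uniform G e e∈E)) ∣K∣<3)
...   | y , y∈e , y∉K =
  (e - y) ∪ ⁅ v ⁆ , compressed⇒shift-edge {G = G} compressed (above y∉K y≢v) e∈E y∈e v∉e ,
  ⁅x⁆∪p⊆q (x∈p∪q⁺ (inj₂ (x∈⁅x⁆ v))) (λ k∈K → x∈p∪q⁺ (inj₁ (x∈p∧x≢y⇒x∈p-y (K⊆e k∈K) (k≢y k∈K))))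
  where
  y≢v : y ≢ v
  y≢v y≡v = v∉e (subst (_∈ e) y≡v y∈e)
  k≢y : ∀ {k} → k ∈ K → k ≢ y
  k≢y k∈K k≡y = y∉K (subst (_∈ K) k≡y k∈K)

2≤⇒∉⁅0⁆∪⁅1⁆ : ∀ {i : Fin (2 + n)} → 2 ≤ toℕ i → i ∉ ⁅ zero ⁆ ∪ ⁅ suc zero ⁆
2≤⇒∉⁅0⁆∪⁅1⁆ {i = suc zero} (s≤s ())
2≤⇒∉⁅0⁆∪⁅1⁆ {i = suc (suc _)} _ i∈⁅0⁆∪⁅1⁆ with x∈⁅y⁆∪⁅z⁆⁻ zero (suc zero) i∈⁅0⁆∪⁅1⁆
... | inj₁ ()
... | inj₂ ()

module _ {m : ℕ} {G : ThreeGraph (3 + m)}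
         (noIsolated : NoIsolated G) (compressed : LeftCompressed G) where

  private
    ℓ : Fin (3 + m)
    ℓ = fromℕ (2 + m)

    ∣⁅ℓ⁆∣<3 : ∣ ⁅ ℓ ⁆ ∣ < 3
    ∣⁅ℓ⁆∣<3 = subst (_< 3) (sym (∣⁅x⁆∣≡1 ℓ)) (s≤s (s≤s z≤n))

    ∣⁅0⁆∪⁅ℓ⁆∣<3 : ∣ ⁅ zero ⁆ ∪ ⁅ ℓ ⁆ ∣ < 3
    ∣⁅0⁆∪⁅ℓ⁆∣<3 = subst (_< 3) (sym (∣⁅x⁆∪⁅y⁆∣≡2 zero ℓ λ ())) (s≤s (s≤s (s≤s z≤n)))

    0<toℕ : ∀ {y : Fin (3 + m)} → y ∉ ⁅ ℓ ⁆ → y ≢ zero → 0 < toℕ y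
    0<toℕ {zero}  _ y≢0 = contradiction refl y≢0
    0<toℕ {suc _} _ _   = s≤s z≤n

    1<toℕ : ∀ {y : Fin (3 + m)} → y ∉ ⁅ zero ⁆ ∪ ⁅ ℓ ⁆ → y ≢ suc zero → 1 < toℕ y
    1<toℕ {zero}        y∉ _   = contradiction (x∈p∪q⁺ {q = ⁅ ℓ ⁆} (inj₁ (x∈⁅x⁆ zero))) y∉
    1<toℕ {suc zero}    _  y≢1 = contradiction refl y≢1
    1<toℕ {suc (suc _)} _  _   = s≤s (s≤s z≤n)

    ⁅1⁆∪⁅0⁆∪⁅ℓ⁆⊆⇒≡ : ∀ {e} → ⁅ suc zero ⁆ ∪ ⁅ zero ⁆ ∪ ⁅ ℓ ⁆ ⊆ e → e ∈E G →
      ⁅ zero ⁆ ∪ ⁅ suc zero ⁆ ∪ ⁅ ℓ ⁆ ≡ e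
    ⁅1⁆∪⁅0⁆∪⁅ℓ⁆⊆⇒≡ {e} ⊆e e∈E = ⊆∧∣q∣≤∣p∣⇒≡
      (⊆-trans (⊆-reflexive (CommutativeSemigroupProperties.x∙yz≈y∙xz
        (CommutativeMonoid.commutativeSemigroup (∪-commutativeMonoid (3 + m)))
        ⁅ zero ⁆ ⁅ suc zero ⁆ ⁅ ℓ ⁆)) ⊆e)
      (ℕ.≤-reflexive (trans (uniform G e e∈E)
        (sym (∣⁅x⁆∪⁅y⁆∪⁅z⁆∣≡3 zero (suc zero) ℓ (λ ()) (λ ()) (λ ())))))

  ⁅0⁆∪⁅1⁆∪⁅last⁆∈E : (⁅ zero ⁆ ∪ ⁅ suc zero ⁆ ∪ ⁅ fromℕ (2 + m) ⁆) ∈E G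
  ⁅0⁆∪⁅1⁆∪⁅last⁆∈E with noIsolated ℓ
  ... | e₀ , e₀∈E , ℓ∈e₀ with compressed⇒absorb {G = G} compressed e₀∈E (⁅x⁆⊆p ℓ∈e₀) ∣⁅ℓ⁆∣<3 0<toℕ
  ... | e₁ , e₁∈E , ⁅0⁆∪⁅ℓ⁆⊆e₁
    with compressed⇒absorb {G = G} compressed e₁∈E ⁅0⁆∪⁅ℓ⁆⊆e₁ ∣⁅0⁆∪⁅ℓ⁆∣<3 1<toℕ
  ... | e₂ , e₂∈E , ⁅1⁆∪⁅0⁆∪⁅ℓ⁆⊆e₂ = subst (_∈E G) (sym (⁅1⁆∪⁅0⁆∪⁅ℓ⁆⊆⇒≡ ⁅1⁆∪⁅0⁆∪⁅ℓ⁆⊆e₂ e₂∈E)) e₂∈E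

  ⁅0⁆∪⁅1⁆∪⁅i⁆∈E : ∀ i → 2 ≤ toℕ i → (⁅ zero ⁆ ∪ ⁅ suc zero ⁆ ∪ ⁅ i ⁆) ∈E G
  ⁅0⁆∪⁅1⁆∪⁅i⁆∈E i 2≤i with i Fin.≟ ℓ
  ... | yes refl = ⁅0⁆∪⁅1⁆∪⁅last⁆∈E
  ... | no i≢ℓ = subst (_∈E G) (∪-assoc ⁅ zero ⁆ ⁅ suc zero ⁆ ⁅ i ⁆)
    (compressed⇒shift {G = G} compressed (Fin.≤∧≢⇒< (Fin.≤fromℕ i) i≢ℓ)
      (∣⁅x⁆∪⁅y⁆∣≡2 {n = 3 + m} zero (suc zero) λ ())
      (2≤⇒∉⁅0⁆∪⁅1⁆ 2≤i) (2≤⇒∉⁅0⁆∪⁅1⁆ {i = ℓ} (s≤s (s≤s z≤n)))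
      (subst (_∈E G) (sym (∪-assoc ⁅ zero ⁆ ⁅ suc zero ⁆ ⁅ ℓ ⁆)) ⁅0⁆∪⁅1⁆∪⁅last⁆∈E))

⁅0⁆∪⁅1⁆-covers : ∀ {k} {G : ThreeGraph (6 + k)} →
  NoIsolated G → NoTwoDisjointEdges G → LeftCompressed G → ∀ A → A ∈E G → zero ∈ A ⊎ suc zero ∈ A
⁅0⁆∪⁅1⁆-covers {k = k} {G = G} noIsolated noDisjoint compressed A A∈E with zero ∈? A | suc zero ∈? A
... | yes 0∈A | _       = inj₁ 0∈A
... | no _    | yes 1∈A = inj₂ 1∈A
... | no 0∉A  | no 1∉A  = contradiction 4≤3 (ℕ.n≮n 3)
  where
  2≤⇒∈A : ∀ z → 2 ≤ toℕ z → z ∈ A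
  2≤⇒∈A z 2≤z with ¬Disjoint⇒∃∈p∩q (noDisjoint (⁅ zero ⁆ ∪ ⁅ suc zero ⁆ ∪ ⁅ z ⁆) A
                     (⁅0⁆∪⁅1⁆∪⁅i⁆∈E {G = G} noIsolated compressed z 2≤z) A∈E)
  ... | x , x∈⁅0,1,z⁆ , x∈A with x∈⁅y⁆∪⁅z⁆∪⁅v⁆⁻ zero (suc zero) z x∈⁅0,1,z⁆
  ...   | inj₁ refl        = contradiction x∈A 0∉A
  ...   | inj₂ (inj₁ refl) = contradiction x∈A 1∉A
  ...   | inj₂ (inj₂ refl) = x∈A
  2+ : Fin (4 + k) → Fin (6 + k)
  2+ i = suc (suc i)
  2+∈A : ∀ i → 2+ i ∈ A
  2+∈A i = 2≤⇒∈A (2+ i) (s≤s (s≤s z≤n))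
  Q : Subset (6 + k)
  Q = ⁅ 2+ zero ⁆ ∪ ⁅ 2+ (suc zero) ⁆ ∪ ⁅ 2+ (suc (suc zero)) ⁆ ∪ ⁅ 2+ (suc (suc (suc zero))) ⁆
  Q⊆A : Q ⊆ A
  Q⊆A = ⁅x⁆∪p⊆q (2+∈A zero) (⁅x⁆∪p⊆q (2+∈A (suc zero))
          (⁅x⁆∪p⊆q (2+∈A (suc (suc zero))) (⁅x⁆⊆p (2+∈A (suc (suc (suc zero)))))))
  -- ∣ Q ∣ normalises to 4 + ∣ (the union of the empty tails) ∣.
  4≤3 : 4 ≤ 3
  4≤3 = ℕ.≤-trans (ℕ.m≤m+n 4 _) (subst (∣ Q ∣ ≤_) (uniform G A A∈E) (p⊆q⇒∣p∣≤∣q∣ Q⊆A))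

AboveTwo⇒0∉ : ∀ {A : Subset (2 + n)} → AboveTwo A → zero ∉ A
AboveTwo⇒0∉ aboveTwo 0∈A with aboveTwo zero 0∈A
... | ()

AboveTwo⇒1∉ : ∀ {A : Subset (2 + n)} → AboveTwo A → suc zero ∉ A
AboveTwo⇒1∉ aboveTwo 1∈A with aboveTwo (suc zero) 1∈A
... | s≤s ()

LPlus? : ∀ (v : Fin n) G → Decidable (LPlus v G)
LPlus? v G A = Fin.all? (λ x → x ∈? A →-dec 2 ℕ.≤? toℕ x) ×-dec (edge G (A ∪ ⁅ v ⁆) Bool.≟ true)

∣LPlus∣≡2 : ∀ {G : ThreeGraph (2 + n)} {A} → LPlus (suc zero) G A → ∣ A ∣ ≡ 2
∣LPlus∣≡2 {G = G} {A} (aboveTwo , A1∈E) = ℕ.suc-injective (begin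
  suc ∣ A ∣             ≡⟨ ∣⁅x⁆∪p∣≡1+∣p∣ (AboveTwo⇒1∉ aboveTwo) ⟨
  ∣ ⁅ suc zero ⁆ ∪ A ∣  ≡⟨ cong ∣_∣ (∪-comm ⁅ suc zero ⁆ A) ⟩
  ∣ A ∪ ⁅ suc zero ⁆ ∣  ≡⟨ uniform G _ A1∈E ⟩
  3                     ∎)
  where open ≡-Reasoning

LPlus⇒A∪⁅0⁆∈E : ∀ {G : ThreeGraph (2 + n)} {A} →
  LeftCompressed G → LPlus (suc zero) G A → (A ∪ ⁅ zero ⁆) ∈E G
LPlus⇒A∪⁅0⁆∈E {G = G} compressed A∈L@(aboveTwo , A1∈E) =
  compressed⇒shift {G = G} compressed (s≤s z≤n) (∣LPlus∣≡2 {G = G} A∈L)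
    (AboveTwo⇒0∉ aboveTwo) (AboveTwo⇒1∉ aboveTwo) A1∈E

LPlus-intersecting : ∀ {G : ThreeGraph (2 + n)} → NoTwoDisjointEdges G → LeftCompressed G →
  ∀ A B → LPlus (suc zero) G A → LPlus (suc zero) G B → ¬ Disjoint A B
LPlus-intersecting {G = G} noDisjoint compressed A B A∈L@(aboveTwoA , _) (aboveTwoB , B1∈E) A∩B≡⊥ =
  noDisjoint (A ∪ ⁅ zero ⁆) (B ∪ ⁅ suc zero ⁆) (LPlus⇒A∪⁅0⁆∈E {G = G} compressed A∈L) B1∈E
    (Disjoint⁺ λ x∈A0 x∈B1 → separated (x∈p∪q⁻ A ⁅ zero ⁆ x∈A0) (x∈p∪q⁻ B ⁅ suc zero ⁆ x∈B1))
  where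
  separated : ∀ {x} → x ∈ A ⊎ x ∈ ⁅ zero ⁆ → ¬ (x ∈ B ⊎ x ∈ ⁅ suc zero ⁆)
  separated (inj₁ x∈A)   (inj₁ x∈B)   = ∉⊥ (subst (_ ∈_) A∩B≡⊥ (x∈p∩q⁺ (x∈A , x∈B)))
  separated (inj₁ x∈A)   (inj₂ x∈⁅1⁆) = AboveTwo⇒1∉ aboveTwoA (subst (_∈ A) (x∈⁅y⁆⇒x≡y _ x∈⁅1⁆) x∈A)
  separated (inj₂ x∈⁅0⁆) (inj₁ x∈B)   = AboveTwo⇒0∉ aboveTwoB (subst (_∈ B) (x∈⁅y⁆⇒x≡y _ x∈⁅0⁆) x∈B)
  separated (inj₂ x∈⁅0⁆) (inj₂ x∈⁅1⁆)
    with trans (sym (x∈⁅y⁆⇒x≡y zero x∈⁅0⁆)) (x∈⁅y⁆⇒x≡y (suc zero) x∈⁅1⁆)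
  ... | ()

lemma4p8 : (k : ℕ) → (G : ThreeGraph (6 + k)) →
    NoIsolated G → NoTwoDisjointEdges G → LeftCompressed G →
    ((i : Fin (6 + k)) → 2 ≤ toℕ i → (⁅ zero ⁆ ∪ ⁅ suc zero ⁆ ∪ ⁅ i ⁆) ∈E G)
    × (∀ A → A ∈E G → (zero ∈ A ⊎ suc zero ∈ A))
    × ((∀ A B → LPlus (suc zero) G A → LPlus (suc zero) G B → ¬ Disjoint A B)
       × ((∃[ A ] LPlus (suc zero) G A) →
          (IsTriangle (LPlus (suc zero) G) ⊎ IsStar (LPlus (suc zero) G))))
lemma4p8 k G noIsolated noDisjoint compressed =
    ⁅0⁆∪⁅1⁆∪⁅i⁆∈E {G = G} noIsolated compressed
  , ⁅0⁆∪⁅1⁆-covers {G = G} noIsolated noDisjoint compressed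
  , L⁺-intersecting
  , intersecting-pairs⇒triangle⊎star (LPlus? (suc zero) G) (∣LPlus∣≡2 {G = G}) L⁺-intersecting
  where
  L⁺-intersecting : ∀ A B → LPlus (suc zero) G A → LPlus (suc zero) G B → ¬ Disjoint A B
  L⁺-intersecting = LPlus-intersecting {G = G} noDisjoint compressed
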